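{- Let $G$ be a simple finite graph with no isolated vertices. Then $G$ admits a prime arithmetic integer additive set-indexer (prime AIASI) if and only if $G$ is bipartite.
   Context: $\mathbb{N}_0$ is the set of non-negative integers and $\mathcal{P}(\mathbb{N}_0)$ its power set; all sets considered are finite. For $A,B\subseteq\mathbb{N}_0$, $A+B=\{a+b: a\in A, b\in B\}$. An integer additive set-indexer (IASI) of $G$ is an injective map $f:V(G)\to\mathcal{P}(\mathbb{N}_0)$ such that the induced map $f^+:E(G)\to\mathcal{P}(\mathbb{N}_0)$, $f^+(uv)=f(u)+f(v)$, is also injective; $|f(v)|$ is the set-indexing number of $v$. An AP-set is a finite set of non-negative integers with at least three elements whose elements form an arithmetic progression; its common difference is called the deterministic index, written $\varpi(x)$ for the set-label of an element $x$. An arithmetic IASI (AIASI) is an IASI $f$ such that $f(v)$ is an AP-set for every vertex $v$ and $f^+(e)$ is an AP-set for every edge $e$. A prime AIASI is an AIASI $f$ such that for any two adjacent vertices $v_i,v_j$ with deterministic indices $d_i\le d_j$, one has $d_j=p\,d_i$ for some prime $p$ with $p\le |f(v_i)|$. -}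

module Defs where

open import Data.Nat using (ℕ; _+_; _*_; _≤_; _<_)
open import Data.Nat.Primality using (Prime)
open import Data.Fin using (Fin)
open import Data.Bool using (Bool)
open import Data.Product using (Σ; ∃; ∃-syntax; _×_; _,_)
open import Data.Sum using (_⊎_)
open import Relation.Binary.PropositionalEquality using (_≡_)
open import Relation.Nullary using (¬_; Dec)
open import Function.Bundles using (_⇔_)

record SimpleGraph (n : ℕ) : Set₁ where
  field
    Adj       : Fin n → Fin n → Set
    Adj-sym   : ∀ {u v} → Adj u v → Adj v u
    Adj-irrefl : ∀ {u} → ¬ Adj u u
    Adj-dec   : ∀ u v → Dec (Adj u v)
open SimpleGraph public

NoIsolatedVertices : ∀ {n} → SimpleGraph n → Set
NoIsolatedVertices {n} G = ∀ (v : Fin n) → ∃[ u ] Adj G v u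

Bipartite : ∀ {n} → SimpleGraph n → Set
Bipartite {n} G = Σ (Fin n → Bool) λ c → ∀ (u v : Fin n) → Adj G u v → ¬ (c u ≡ c v)

SetN : Set₁
SetN = ℕ → Set

_≐_ : SetN → SetN → Set
A ≐ B = ∀ x → (A x → B x) × (B x → A x)

_⊕_ : SetN → SetN → SetN
(A ⊕ B) x = ∃[ a ] ∃[ b ] (A a × B b × a + b ≡ x)

-- A is the AP-set {a, a+d, ..., a+(k-1)d} with k ≥ 3 elements and
-- common difference (deterministic index) d ≥ 1; then |A| = k.
IsAPWith : SetN → (a d k : ℕ) → Set
IsAPWith A a d k =
  (3 ≤ k) × (1 ≤ d) × (∀ x → (A x → ∃[ i ] (i < k × x ≡ a + i * d))
                           × (∃[ i ] (i < k × x ≡ a + i * d) → A x))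

IsAPSet : SetN → Set
IsAPSet A = ∃[ a ] ∃[ d ] ∃[ k ] IsAPWith A a d k

IsIASI : ∀ {n} → SimpleGraph n → (Fin n → SetN) → Set
IsIASI {n} G f =
  (∀ (u v : Fin n) → f u ≐ f v → u ≡ v) ×
  (∀ (u v u' v' : Fin n) → Adj G u v → Adj G u' v' →
     (f u ⊕ f v) ≐ (f u' ⊕ f v') →
     (u ≡ u' × v ≡ v') ⊎ (u ≡ v' × v ≡ u'))

IsAIASI : ∀ {n} → SimpleGraph n → (Fin n → SetN) → Set
IsAIASI {n} G f =
  IsIASI G f × (∀ v → IsAPSet (f v)) ×
  (∀ (u v : Fin n) → Adj G u v → IsAPSet (f u ⊕ f v))

-- Prime AIASI: for adjacent u, v with deterministic indices d_u ≤ d_v,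
-- d_v = p * d_u for a prime p ≤ |f(u)|.  (The AP presentation of an
-- AP-set is unique, so quantifying over all presentations is faithful.)
IsPrimeAIASI : ∀ {n} → SimpleGraph n → (Fin n → SetN) → Set
IsPrimeAIASI {n} G f =
  IsAIASI G f ×
  (∀ (u v : Fin n) → Adj G u v →
     ∀ au du ku av dv kv → IsAPWith (f u) au du ku → IsAPWith (f v) av dv kv →
     du ≤ dv → ∃[ p ] (Prime p × p ≤ ku × dv ≡ p * du))

HasPrimeAIASI : ∀ {n} → SimpleGraph n → Set₁
HasPrimeAIASI {n} G = Σ (Fin n → SetN) (IsPrimeAIASI G)

module Submission where

-- (⇒) Let d v be the deterministic index of the set-label of v.  Along
-- every edge the larger index is a prime multiple of the smaller one, so
-- Ω(d), the number of prime factors counted with multiplicity, changes by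
-- exactly one; the parity of Ω(d v) is therefore a proper 2-colouring.
--
-- (⇐) Given a proper 2-colouring c of G on the vertices Fin n, label a
-- vertex x of colour false by {x, x+1, x+2} and a vertex y of colour true
-- by {yn, yn+2, yn+4}.  Every edge joins one vertex of each colour, and its
-- sumset is the 7-term progression starting at x + yn with difference 1.
-- Since an AP-set determines its first term and difference, injectivity
-- of the vertex and edge labels reduces to the uniqueness of the base-n
-- digits (x, y) of x + yn, and the prime condition holds with p = 2.

open import Defs
open import Data.Nat using (ℕ)
open import Function.Bundles using (_⇔_)

open import Data.Nat.Base using (zero; suc; _+_; _*_; _≤_; _<_; z≤n; s≤s; NonZero; >-nonZero; ≢-nonZero⁻¹)
open import Data.Nat.Properties
open import Data.Nat.DivMod using (_%_; m<n⇒m%n≡m; [m+kn]%n≡m%n)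
open import Data.Nat.Primality using (Prime; prime⇒nonZero; prime[2])
open import Data.Nat.Primality.Factorisation
  using (PrimeFactorisation; factors; factorise; factorisationUnique)
open import Data.Nat.Tactic.RingSolver using (solve-∀)
open import Data.List using (length; _∷_)
open import Data.List.Relation.Unary.All using (_∷_)
open import Data.List.Relation.Binary.Permutation.Propositional.Properties using (↭-length)
open import Data.Fin using (Fin; toℕ)
open import Data.Fin.Properties using (toℕ-injective; toℕ<n)
open import Data.Bool using (Bool; true; false; not)
open import Data.Bool.Properties using (not-¬)
open import Data.Product using (∃-syntax; _×_; _,_; proj₁; proj₂)
open import Data.Sum using (_⊎_; inj₁; inj₂)
open import Data.Empty using (⊥-elim)
open import Relation.Nullary using (¬_)
open import Relation.Binary.PropositionalEquality
open import Function.Bundles using (mk⇔)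
open import Function.Base using (_∘_)

≐-refl : ∀ {A} → A ≐ A
≐-refl x = (λ a → a) , (λ a → a)

≐-sym : ∀ {A B} → A ≐ B → B ≐ A
≐-sym A≐B x = proj₂ (A≐B x) , proj₁ (A≐B x)

≐-trans : ∀ {A B C} → A ≐ B → B ≐ C → A ≐ C
≐-trans A≐B B≐C x = (λ a → proj₁ (B≐C x) (proj₁ (A≐B x) a))
                   , (λ c → proj₂ (A≐B x) (proj₂ (B≐C x) c))

⊕-comm : ∀ A B → (A ⊕ B) ≐ (B ⊕ A)
⊕-comm A B x = swap , swap
  where
  swap : ∀ {C D} → (C ⊕ D) x → (D ⊕ C) x
  swap (a , b , Ca , Db , a+b≡x) = b , a , Db , Ca , trans (+-comm b a) a+b≡x

IsAPWith-resp-≐ : ∀ {A B a d k} → A ≐ B → IsAPWith A a d k → IsAPWith B a d k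
IsAPWith-resp-≐ A≐B (3≤k , 1≤d , A-is) =
  3≤k , 1≤d , λ x → (λ Bx → proj₁ (A-is x) (proj₂ (A≐B x) Bx))
                  , (λ i → proj₁ (A≐B x) (proj₂ (A-is x) i))

-- Uniqueness of AP presentations: first term and difference of an AP-set
-- are determined by the set (its minimum and its gap to the next element).

module _ {A : SetN} {a d k : ℕ} (A-AP : IsAPWith A a d k) where

  term∈ : ∀ i → i < k → A (a + i * d)
  term∈ i i<k = proj₂ (proj₂ (proj₂ A-AP) _) (i , i<k , refl)

  ∈⇒term : ∀ {x} → A x → ∃[ i ] (i < k × x ≡ a + i * d)
  ∈⇒term Ax = proj₁ (proj₂ (proj₂ A-AP) _) Ax

  first∈ : A a
  first∈ = subst A (+-identityʳ a) (term∈ 0 (≤-trans (s≤s z≤n) (proj₁ A-AP)))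

  second∈ : A (a + d)
  second∈ = subst A (cong (a +_) (+-identityʳ d)) (term∈ 1 (≤-trans (s≤s (s≤s z≤n)) (proj₁ A-AP)))

-- Every element of B is at least its first term a', in particular a ∈ B.
first-≤ : ∀ {A B a d k a' d' k'} → IsAPWith A a d k → IsAPWith B a' d' k' → A ≐ B → a' ≤ a
first-≤ {a = a} {a' = a'} {d' = d'} A-AP B-AP A≐B with ∈⇒term B-AP (proj₁ (A≐B a) (first∈ A-AP))
... | i , _ , a≡ = subst (a' ≤_) (sym a≡) (m≤m+n a' (i * d'))

-- With equal first terms, a + d ∈ B lies strictly above a, so d' ≤ d.
diff-≤ : ∀ {A B a d k d' k'} → IsAPWith A a d k → IsAPWith B a d' k' → A ≐ B → d' ≤ d
diff-≤ {a = a} {d = d} {d' = d'} A-AP B-AP A≐B with ∈⇒term B-AP (proj₁ (A≐B _) (second∈ A-AP))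
... | zero  , _ , a+d≡a = ⊥-elim (1+n≰n (≤-trans (proj₁ (proj₂ A-AP)) (≤-reflexive (+-cancelˡ-≡ a d 0 a+d≡a))))
... | suc j , _ , a+d≡  = subst (d' ≤_) (sym (+-cancelˡ-≡ a d (d' + j * d') a+d≡)) (m≤m+n d' (j * d'))

AP-presentation-unique : ∀ {A B a d k a' d' k'} → IsAPWith A a d k → IsAPWith B a' d' k' →
                         A ≐ B → a ≡ a' × d ≡ d'
AP-presentation-unique A-AP B-AP A≐B with ≤-antisym (first-≤ B-AP A-AP (≐-sym A≐B)) (first-≤ A-AP B-AP A≐B)
... | refl = refl , ≤-antisym (diff-≤ B-AP A-AP (≐-sym A≐B)) (diff-≤ A-AP B-AP A≐B)

Progression : ℕ → ℕ → ℕ → SetN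
Progression a d k x = ∃[ i ] (i < k × x ≡ a + i * d)

Progression-isAP : ∀ {a d k} → 3 ≤ k → 1 ≤ d → IsAPWith (Progression a d k) a d k
Progression-isAP 3≤k 1≤d = 3≤k , 1≤d , λ x → (λ p → p) , (λ p → p)

-- {a, a+1, a+2} + {b, b+2, b+4} = {a+b, a+b+1, …, a+b+6}: the index
-- i + 2j with i, j < 3 runs exactly through 0, …, 6.
Progression-sum : ∀ a b → IsAPWith (Progression a 1 3 ⊕ Progression b 2 3) (a + b) 1 7
Progression-sum a b = s≤s (s≤s (s≤s z≤n)) , s≤s z≤n , λ x → sum⇒term x , term⇒sum x
  where
  regroup : ∀ a b i j → a + i * 1 + (b + j * 2) ≡ a + b + (i + j * 2) * 1
  regroup = solve-∀

  index< : ∀ {i j} → i < 3 → j < 3 → i + j * 2 < 7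
  index< i<3 j<3 = s≤s (+-mono-≤ (≤-pred i<3) (*-monoˡ-≤ 2 (≤-pred j<3)))

  index-split : ∀ m → m < 7 → ∃[ i ] ∃[ j ] (i < 3 × j < 3 × i + j * 2 ≡ m)
  index-split 0 _ = 0 , 0 , s≤s z≤n , s≤s z≤n , refl
  index-split 1 _ = 1 , 0 , s≤s (s≤s z≤n) , s≤s z≤n , refl
  index-split 2 _ = 2 , 0 , s≤s (s≤s (s≤s z≤n)) , s≤s z≤n , refl
  index-split 3 _ = 1 , 1 , s≤s (s≤s z≤n) , s≤s (s≤s z≤n) , refl
  index-split 4 _ = 2 , 1 , s≤s (s≤s (s≤s z≤n)) , s≤s (s≤s z≤n) , refl
  index-split 5 _ = 1 , 2 , s≤s (s≤s z≤n) , s≤s (s≤s (s≤s z≤n)) , refl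
  index-split 6 _ = 2 , 2 , s≤s (s≤s (s≤s z≤n)) , s≤s (s≤s (s≤s z≤n)) , refl
  index-split (suc (suc (suc (suc (suc (suc (suc m))))))) (s≤s (s≤s (s≤s (s≤s (s≤s (s≤s (s≤s ())))))))

  sum⇒term : ∀ x → (Progression a 1 3 ⊕ Progression b 2 3) x → Progression (a + b) 1 7 x
  sum⇒term x (_ , _ , (i , i<3 , refl) , (j , j<3 , refl) , refl) = i + j * 2 , index< i<3 j<3 , regroup a b i j

  term⇒sum : ∀ x → Progression (a + b) 1 7 x → (Progression a 1 3 ⊕ Progression b 2 3) x
  term⇒sum x (m , m<7 , refl) with index-split m m<7
  ... | i , j , i<3 , j<3 , refl = _ , _ , (i , i<3 , refl) , (j , j<3 , refl) , regroup a b i j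

digits-unique : ∀ {n x x' y y'} → x < n → x' < n → x + y * n ≡ x' + y' * n → x ≡ x' × y ≡ y'
digits-unique {n} {x} {x'} {y} {y'} x<n x'<n eq = x≡x' , y≡y'
  where
  instance
    n≢0 : NonZero n
    n≢0 = >-nonZero (≤-trans (s≤s z≤n) x<n)

  open ≡-Reasoning
  x≡x' : x ≡ x'
  x≡x' = begin
    x                ≡⟨ m<n⇒m%n≡m x<n ⟨
    x % n            ≡⟨ [m+kn]%n≡m%n x y n ⟨
    (x + y * n) % n   ≡⟨ cong (_% n) eq ⟩
    (x' + y' * n) % n ≡⟨ [m+kn]%n≡m%n x' y' n ⟩
    x' % n           ≡⟨ m<n⇒m%n≡m x'<n ⟩
    x'               ∎

  y≡y' : y ≡ y'
  y≡y' = *-cancelʳ-≡ y y' n (+-cancelˡ-≡ x _ _ (trans eq (cong (_+ y' * n) (sym x≡x'))))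

Ω : ℕ → ℕ
Ω zero    = zero
Ω (suc m) = length (factors (factorise (suc m)))

-- Multiplying by a prime adds one prime factor, by unique factorisation.
Ω-prime-* : ∀ {p d} → Prime p → 1 ≤ d → Ω (p * d) ≡ suc (Ω d)
Ω-prime-* {zero} p-prime _ = ⊥-elim (≢-nonZero⁻¹ 0 {{prime⇒nonZero p-prime}} refl)
Ω-prime-* {suc p} {suc m} p-prime _ = ↭-length (factorisationUnique (factorise _) p·factors)
  where
  m-factors : PrimeFactorisation (suc m)
  m-factors = factorise (suc m)

  p·factors : PrimeFactorisation (suc p * suc m)
  p·factors = record
    { factors         = suc p ∷ factors m-factors
    ; isFactorisation = cong (suc p *_) (PrimeFactorisation.isFactorisation m-factors)
    ; factorsPrime    = p-prime ∷ PrimeFactorisation.factorsPrime m-factors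
    }

parity : ℕ → Bool
parity zero    = false
parity (suc m) = not (parity m)

prime-ratio⇒bipartite : ∀ {n} (G : SimpleGraph n) (d : Fin n → ℕ) → (∀ v → 1 ≤ d v) →
  (∀ u v → Adj G u v → d u ≤ d v → ∃[ p ] (Prime p × d v ≡ p * d u)) → Bipartite G
prime-ratio⇒bipartite G d d≥1 ratio = colour , proper
  where
  colour : Fin _ → Bool
  colour v = parity (Ω (d v))

  ordered : ∀ u v → Adj G u v → d u ≤ d v → ¬ colour u ≡ colour v
  ordered u v uv du≤dv same with ratio u v uv du≤dv
  ... | p , p-prime , dv≡p·du = not-¬ refl (trans same flips)
    where
    open ≡-Reasoning
    flips : colour v ≡ not (colour u)
    flips = begin
      parity (Ω (d v))       ≡⟨ cong (parity ∘ Ω) dv≡p·du ⟩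
      parity (Ω (p * d u))   ≡⟨ cong parity (Ω-prime-* p-prime (d≥1 u)) ⟩
      not (parity (Ω (d u))) ∎

  proper : ∀ u v → Adj G u v → ¬ colour u ≡ colour v
  proper u v uv with ≤-total (d u) (d v)
  ... | inj₁ du≤dv = ordered u v uv du≤dv
  ... | inj₂ dv≤du = λ same → ordered v u (Adj-sym G uv) dv≤du (sym same)

prime-AIASI⇒bipartite : ∀ {n} (G : SimpleGraph n) → HasPrimeAIASI G → Bipartite G
prime-AIASI⇒bipartite G (f , (_ , vertex-AP , _) , prime) =
  prime-ratio⇒bipartite G index (λ v → proj₁ (proj₂ (presentation v))) ratio
  where
  index : Fin _ → ℕ
  index v = proj₁ (proj₂ (vertex-AP v))

  presentation : ∀ v → IsAPWith (f v) (proj₁ (vertex-AP v)) (index v) (proj₁ (proj₂ (proj₂ (vertex-AP v))))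
  presentation v = proj₂ (proj₂ (proj₂ (vertex-AP v)))

  ratio : ∀ u v → Adj G u v → index u ≤ index v → ∃[ p ] (Prime p × index v ≡ p * index u)
  ratio u v uv ≤index with prime u v uv _ _ _ _ _ _ (presentation u) (presentation v) ≤index
  ... | p , p-prime , _ , index≡ = p , p-prime , index≡

SameEdge : ∀ {A : Set} → A → A → A → A → Set
SameEdge u v x y = (u ≡ x × v ≡ y) ⊎ (u ≡ y × v ≡ x)

SameEdge-trans : ∀ {A : Set} {u v u' v' x y : A} → SameEdge u v x y → SameEdge u' v' x y → SameEdge u v u' v'
SameEdge-trans (inj₁ (refl , refl)) (inj₁ (refl , refl)) = inj₁ (refl , refl)
SameEdge-trans (inj₁ (refl , refl)) (inj₂ (refl , refl)) = inj₂ (refl , refl)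
SameEdge-trans (inj₂ (refl , refl)) (inj₁ (refl , refl)) = inj₂ (refl , refl)
SameEdge-trans (inj₂ (refl , refl)) (inj₂ (refl , refl)) = inj₁ (refl , refl)

SameEdge-⊕ : ∀ {A : Set} (f : A → SetN) {u v x y} → SameEdge u v x y → (f u ⊕ f v) ≐ (f x ⊕ f y)
SameEdge-⊕ f (inj₁ (refl , refl)) = ≐-refl
SameEdge-⊕ f (inj₂ (refl , refl)) = ⊕-comm (f _) (f _)

module Labelling {n} (G : SimpleGraph n) (c : Fin n → Bool)
                 (proper : ∀ u v → Adj G u v → ¬ c u ≡ c v) where

  step : Bool → ℕ
  step false = 1
  step true  = 2

  encode : Bool → Fin n → ℕ
  encode false x = toℕ x
  encode true  y = toℕ y * n

  label : Fin n → SetN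
  label v = Progression (encode (c v) v) (step (c v)) 3

  step≥1 : ∀ b → 1 ≤ step b
  step≥1 false = s≤s z≤n
  step≥1 true  = s≤s z≤n

  label-AP : ∀ v → IsAPWith (label v) (encode (c v) v) (step (c v)) 3
  label-AP v = Progression-isAP ≤-refl (step≥1 (c v))

  step-injective : ∀ {b b'} → step b ≡ step b' → b ≡ b'
  step-injective {false} {false} _ = refl
  step-injective {true}  {true}  _ = refl

  encode-injective : ∀ b x y → encode b x ≡ encode b y → x ≡ y
  encode-injective false x y eq = toℕ-injective eq
  encode-injective true  x y eq =
    toℕ-injective (proj₂ (digits-unique {x = 0} (≤-trans (s≤s z≤n) (toℕ<n x)) (≤-trans (s≤s z≤n) (toℕ<n x)) eq))

  -- Vertex labels are distinct: a label determines colour and first term.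
  label-injective : ∀ u v → label u ≐ label v → u ≡ v
  label-injective u v label≐ with AP-presentation-unique (label-AP u) (label-AP v) label≐
  ... | encode≡ , step≡ =
    encode-injective (c v) u v (trans (cong (λ b → encode b u) (sym (step-injective step≡))) encode≡)

  record Oriented (u v : Fin n) : Set where
    field
      low high    : Fin n
      low-colour  : c low ≡ false
      high-colour : c high ≡ true
      same        : SameEdge u v low high
  open Oriented

  orient : ∀ {u v} → Adj G u v → Oriented u v
  orient {u} {v} uv with c u in cu | c v in cv
  ... | false | false = ⊥-elim (proper u v uv (trans cu (sym cv)))
  ... | false | true  = record { low = u ; high = v ; low-colour = cu ; high-colour = cv ; same = inj₁ (refl , refl) }
  ... | true  | false = record { low = v ; high = u ; low-colour = cv ; high-colour = cu ; same = inj₂ (refl , refl) }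
  ... | true  | true  = ⊥-elim (proper u v uv (trans cu (sym cv)))

  edge-AP : ∀ {u v} (o : Oriented u v) → IsAPWith (label u ⊕ label v) (toℕ (low o) + toℕ (high o) * n) 1 7
  edge-AP o = IsAPWith-resp-≐ (≐-sym (SameEdge-⊕ label (same o)))
    (subst₂ (λ b b' → IsAPWith (Progression (encode b (low o)) (step b) 3 ⊕ Progression (encode b' (high o)) (step b') 3)
                               (toℕ (low o) + toℕ (high o) * n) 1 7)
            (sym (low-colour o)) (sym (high-colour o)) (Progression-sum _ _))

  -- Edge labels are distinct: the first term fixes low and high as digits.
  edge-injective : ∀ u v u' v' → Adj G u v → Adj G u' v' →
                   (label u ⊕ label v) ≐ (label u' ⊕ label v') → SameEdge u v u' v'
  edge-injective u v u' v' uv u'v' sum≐ with orient uv | orient u'v'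
  ... | o | o' with digits-unique (toℕ<n (low o)) (toℕ<n (low o'))
                      (proj₁ (AP-presentation-unique (edge-AP o) (edge-AP o') sum≐))
  ... | low≡ , high≡ =
    SameEdge-trans (same o) (subst₂ (SameEdge u' v') (toℕ-injective (sym low≡)) (toℕ-injective (sym high≡)) (same o'))

  step-ratio : ∀ {b b' k} → ¬ b ≡ b' → step b ≤ step b' → 3 ≤ k → ∃[ p ] (Prime p × p ≤ k × step b' ≡ p * step b)
  step-ratio {false} {false} b≢b' _ _ = ⊥-elim (b≢b' refl)
  step-ratio {false} {true}  _ _ 3≤k = 2 , prime[2] , ≤-trans (n≤1+n 2) 3≤k , refl
  step-ratio {true}  {false} _ (s≤s ()) _
  step-ratio {true}  {true}  b≢b' _ _ = ⊥-elim (b≢b' refl)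

  label-isPrimeAIASI : IsPrimeAIASI G label
  label-isPrimeAIASI =
    ((label-injective , edge-injective) , (λ v → _ , _ , _ , label-AP v) , (λ u v uv → _ , _ , _ , edge-AP (orient uv))) ,
    prime-condition
    where
    prime-condition : ∀ u v → Adj G u v → ∀ au du ku av dv kv → IsAPWith (label u) au du ku →
                      IsAPWith (label v) av dv kv → du ≤ dv → ∃[ p ] (Prime p × p ≤ ku × dv ≡ p * du)
    prime-condition u v uv _ _ _ _ _ _ u-AP v-AP du≤dv
      with proj₂ (AP-presentation-unique u-AP (label-AP u) ≐-refl)
         | proj₂ (AP-presentation-unique v-AP (label-AP v) ≐-refl)
    ... | refl | refl = step-ratio (proper u v uv) du≤dv (proj₁ u-AP)

bipartite⇒prime-AIASI : ∀ {n} (G : SimpleGraph n) → Bipartite G → HasPrimeAIASI G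
bipartite⇒prime-AIASI G (c , proper) = Labelling.label G c proper , Labelling.label-isPrimeAIASI G c proper

theorem2p2 : ∀ (n : ℕ) (G : SimpleGraph n) → NoIsolatedVertices G →
    HasPrimeAIASI G ⇔ Bipartite G
theorem2p2 n G _ = mk⇔ (prime-AIASI⇒bipartite G) (bipartite⇒prime-AIASI G)
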